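{- For every $m\ge0$ and every path connected finite space $P$, $\mathrm{CC}_{m+1}(P)\le\mathrm{CC}_m(P)$.
   Context: A finite space is a finite $T_0$ topological space, identified with a finite poset (open sets are down-sets; continuous maps are order-preserving maps). $J_m$ is the finite fence on $\{0,\dots,m\}$ with order $0<1>2<\cdots m$; $P^{J_m}$ is the finite space of continuous maps $J_m\to P$ with the pointwise order; $q_m:P^{J_m}\to P\times P$, $q_m(\gamma)=(\gamma(0),\gamma(m))$. $\mathrm{CC}_m(P)$ is the smallest $n\ge0$ such that there is an open cover $\{Q_i\}_{i=1}^n$ of $P\times P$ with a continuous section $Q_i\to P^{J_m}$ of $q_m$ for each $i$ ($\infty$ if none). -}

module Defs where

open import Level using (0ℓ)
open import Data.Nat using (ℕ; zero; suc; _%_)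
open import Data.Fin using (Fin; toℕ; fromℕ)
open import Data.Bool using (Bool; true)
open import Data.Product using (Σ; ∃; _×_; _,_; proj₁; proj₂)
open import Data.Sum using (_⊎_)
open import Relation.Binary.PropositionalEquality using (_≡_)
open import Relation.Binary.Structures using (IsPartialOrder)

-- A finite space = finite T0 space = finite poset.  Its points are
-- enumerated as Fin size; open sets are down-sets, continuous maps are
-- order-preserving maps.
record FinPoset : Set₁ where
  field
    size           : ℕ
    _≤_            : Fin size → Fin size → Set
    isPartialOrder : IsPartialOrder _≡_ _≤_

  Pt : Set
  Pt = Fin size

open FinPoset public

-- The fence J_m on {0,...,m}: 0 < 1 > 2 < 3 > ...
-- i ≤ j  iff  i = j, or j is odd and |i - j| = 1.
IsOdd : ℕ → Set
IsOdd n = n % 2 ≡ 1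

_≤J_ : {m : ℕ} → Fin (suc m) → Fin (suc m) → Set
i ≤J j = (i ≡ j) ⊎ (IsOdd (toℕ j) × ((toℕ i ≡ suc (toℕ j)) ⊎ (suc (toℕ i) ≡ toℕ j)))

IsContinuousPath : (P : FinPoset) (m : ℕ) → (Fin (suc m) → Pt P) → Set
IsContinuousPath P m γ = ∀ i j → i ≤J j → _≤_ P (γ i) (γ j)

PathSpace : FinPoset → ℕ → Set
PathSpace P m = Σ (Fin (suc m) → Pt P) (IsContinuousPath P m)

_≤Path_ : {P : FinPoset} {m : ℕ} → PathSpace P m → PathSpace P m → Set
_≤Path_ {P} γ δ = ∀ i → _≤_ P (proj₁ γ i) (proj₁ δ i)

q : (P : FinPoset) (m : ℕ) → PathSpace P m → Pt P × Pt P
q P m γ = proj₁ γ Fin.zero , proj₁ γ (fromℕ m)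

_≤×_ : {P : FinPoset} → Pt P × Pt P → Pt P × Pt P → Set
_≤×_ {P} (a , b) (c , d) = _≤_ P a c × _≤_ P b d

-- A subset of P × P (given by its characteristic function, so that
-- membership proofs are unique) which is open, i.e. a down-set.
Subset² : FinPoset → Set
Subset² P = Pt P × Pt P → Bool

IsOpen² : (P : FinPoset) → Subset² P → Set
IsOpen² P Q = ∀ x y → _≤×_ {P} x y → Q y ≡ true → Q x ≡ true

Section : (P : FinPoset) (m : ℕ) (Q : Subset² P) → Set
Section P m Q =
  Σ ((x : Pt P × Pt P) → Q x ≡ true → PathSpace P m) λ s →
    (∀ x (h : Q x ≡ true) → q P m (s x h) ≡ x)
    × (∀ x y (hx : Q x ≡ true) (hy : Q y ≡ true) →
         _≤×_ {P} x y → _≤Path_ {P} {m} (s x hx) (s y hy))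

-- An open cover {Q_i}_{i=1}^n of P × P with a continuous section of q_m
-- on each Q_i.  "CC_m(P) ≤ n" holds iff such a cover with n members exists
-- (covers can be padded with the empty open set, which has a section).
CC≤ : (m : ℕ) (P : FinPoset) (n : ℕ) → Set
CC≤ m P n =
  Σ (Fin n → Subset² P) λ Q →
    (∀ i → IsOpen² P (Q i))
    × (∀ x → ∃ λ i → Q i x ≡ true)
    × (∀ i → Section P m (Q i))

-- Path connectedness of a finite space: any two points are joined by a
-- continuous map from some fence J_k (equivalent to path connectedness for
-- finite spaces; real intervals are unavailable in agda-stdlib).
PathConnected : FinPoset → Set
PathConnected P =
  ∀ (x y : Pt P) → ∃ λ k → Σ (PathSpace P k) λ γ → q P k γ ≡ (x , y)

{-# OPTIONS --safe #-}
module Submission where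

-- Reparametrising paths along a continuous map J_k → J_m with 0 ↦ 0 and
-- k ↦ m is monotone on path spaces and commutes with the endpoint maps, so
-- it turns every section of q_m over an open set into a section of q_k over
-- the same set.  For m ≤ k the truncation i ↦ min(i, m) is such a map: two
-- adjacent points of the fence lie both in [0, m] or both in [m, k].  Hence
-- CC_k(P) ≤ CC_m(P) for every finite space P.

open import Defs hiding (_≤_)
open import Data.Nat using (ℕ; suc; _≤_; _⊓_; s≤s)
open import Data.Nat.Properties
  using (≤-<-connex; <⇒≤; m≤n⇒m≤1+n; n≤1+n; m⊓n≤n; m≤n⇒m⊓n≡m; m≥n⇒m⊓n≡n)
open import Data.Fin using (Fin; toℕ; fromℕ; fromℕ<)
open import Data.Fin.Properties using (toℕ-injective; toℕ-fromℕ; toℕ-fromℕ<)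
open import Data.Product using (_×_; _,_)
import Data.Product as ×
open import Data.Sum using (_⊎_; inj₁; inj₂; map)
open import Function using (_∘_)
open import Relation.Binary.PropositionalEquality
  using (_≡_; refl; sym; trans; cong; cong₂; subst; subst₂; module ≡-Reasoning)

Adjacent : ℕ → ℕ → Set
Adjacent a b = (a ≡ suc b) ⊎ (suc a ≡ b)

successor-same-side : ∀ m b → (suc b ≤ m × b ≤ m) ⊎ (m ≤ suc b × m ≤ b)
successor-same-side m b with ≤-<-connex m b
... | inj₁ m≤b = inj₂ (m≤n⇒m≤1+n m≤b , m≤b)
... | inj₂ b<m = inj₁ (b<m , <⇒≤ b<m)

Adjacent-same-side : ∀ m {a b} → Adjacent a b → (a ≤ m × b ≤ m) ⊎ (m ≤ a × m ≤ b)
Adjacent-same-side m {b = b} (inj₁ refl) = successor-same-side m b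
Adjacent-same-side m {a = a} (inj₂ refl) = map ×.swap ×.swap (successor-same-side m a)

≤J-toℕ-invariant : ∀ {k m} {i j : Fin (suc k)} {i′ j′ : Fin (suc m)} →
                   toℕ i ≡ toℕ i′ → toℕ j ≡ toℕ j′ → i ≤J j → i′ ≤J j′
≤J-toℕ-invariant i≡i′ j≡j′ (inj₁ refl) = inj₁ (toℕ-injective (trans (sym i≡i′) j≡j′))
≤J-toℕ-invariant i≡i′ j≡j′ (inj₂ step) =
  inj₂ (subst₂ (λ a b → IsOdd b × Adjacent a b) i≡i′ j≡j′ step)

record FenceMap (k m : ℕ) : Set where
  field
    fun      : Fin (suc k) → Fin (suc m)
    monotone : ∀ {i j} → i ≤J j → fun i ≤J fun j
    fun-zero : fun Fin.zero ≡ Fin.zero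
    fun-last : fun (fromℕ k) ≡ fromℕ m

module Reparametrise {P : FinPoset} {k m : ℕ} (f : FenceMap k m) where
  open FenceMap f

  reparametrise : PathSpace P m → PathSpace P k
  reparametrise (γ , γ-cont) = γ ∘ fun , λ i j i≤j → γ-cont (fun i) (fun j) (monotone i≤j)

  q-reparametrise : ∀ γ → q P k (reparametrise γ) ≡ q P m γ
  q-reparametrise (γ , _) = cong₂ _,_ (cong γ fun-zero) (cong γ fun-last)

  reparametrise-mono : ∀ {γ δ} → _≤Path_ {P} {m} γ δ →
                       _≤Path_ {P} {k} (reparametrise γ) (reparametrise δ)
  reparametrise-mono γ≤δ i = γ≤δ (fun i)

  Section-reparametrise : ∀ {Q} → Section P m Q → Section P k Q
  Section-reparametrise (s , q∘s≡id , s-mono) =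
    (λ x h → reparametrise (s x h)) ,
    (λ x h → trans (q-reparametrise (s x h)) (q∘s≡id x h)) ,
    (λ x y hx hy x≤y → reparametrise-mono {s x hx} {s y hy} (s-mono x y hx hy x≤y))

  CC≤-reparametrise : ∀ {n} → CC≤ m P n → CC≤ k P n
  CC≤-reparametrise (Q , Q-open , Q-cover , Q-section) =
    Q , Q-open , Q-cover , Section-reparametrise ∘ Q-section

module Truncate {k m : ℕ} (m≤k : m ≤ k) where

  truncate : Fin (suc k) → Fin (suc m)
  truncate i = fromℕ< (s≤s (m⊓n≤n (toℕ i) m))

  toℕ-truncate : ∀ i → toℕ (truncate i) ≡ toℕ i ⊓ m
  toℕ-truncate i = toℕ-fromℕ< (s≤s (m⊓n≤n (toℕ i) m))

  truncate-below : ∀ i → toℕ i ≤ m → toℕ (truncate i) ≡ toℕ i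
  truncate-below i i≤m = trans (toℕ-truncate i) (m≤n⇒m⊓n≡m i≤m)

  truncate-above : ∀ i → m ≤ toℕ i → toℕ (truncate i) ≡ m
  truncate-above i m≤i = trans (toℕ-truncate i) (m≥n⇒m⊓n≡n m≤i)

  truncate-mono : ∀ {i j} → i ≤J j → truncate i ≤J truncate j
  truncate-mono (inj₁ refl) = inj₁ refl
  truncate-mono {i} {j} i≤j@(inj₂ (_ , adj)) with Adjacent-same-side m adj
  ... | inj₁ (i≤m , j≤m) =
    ≤J-toℕ-invariant (sym (truncate-below i i≤m)) (sym (truncate-below j j≤m)) i≤j
  ... | inj₂ (m≤i , m≤j) =
    inj₁ (toℕ-injective (trans (truncate-above i m≤i) (sym (truncate-above j m≤j))))

  truncate-last : truncate (fromℕ k) ≡ fromℕ m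
  truncate-last = toℕ-injective (begin
    toℕ (truncate (fromℕ k)) ≡⟨ truncate-above (fromℕ k) m≤toℕ-fromℕ-k ⟩
    m                        ≡⟨ sym (toℕ-fromℕ m) ⟩
    toℕ (fromℕ m)            ∎)
    where
    open ≡-Reasoning
    m≤toℕ-fromℕ-k : m ≤ toℕ (fromℕ k)
    m≤toℕ-fromℕ-k = subst (m ≤_) (sym (toℕ-fromℕ k)) m≤k

  truncation : FenceMap k m
  truncation = record
    { fun      = truncate
    ; monotone = truncate-mono
    ; fun-zero = refl
    ; fun-last = truncate-last
    }

CC≤-antitone : ∀ {m k} (P : FinPoset) {n} → m ≤ k → CC≤ m P n → CC≤ k P n
CC≤-antitone P m≤k = Reparametrise.CC≤-reparametrise {P} (Truncate.truncation m≤k)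

lemma2p4 : (m : ℕ) (P : FinPoset) → PathConnected P →
           (n : ℕ) → CC≤ m P n → CC≤ (suc m) P n
lemma2p4 m P _ n = CC≤-antitone P (n≤1+n m)
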